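{- Let $q \ge 2$ be an integer. For a positive integer $n$ define $$A_{n,q} = \{(x_1,\dots,x_n) \in \mathbf{Z}^n \mid x_1 + \cdots + x_n \le 1.32 n,\ 0 \le x_i \le q-1 \text{ for } 1 \le i \le n\}$$ and $$B_n = \{(x_1,\dots,x_n) \in \mathbf{Z}^n \mid |\{ i : x_i = 0\}| \ge 0.5657 n\}.$$ Then there is a constant $c > 1$ such that for all sufficiently large $n$, $$\frac{|A_{n,q} \cap B_n|}{|A_{n,q}|} < c^{ -n}.$$ -}

module Defs where

open import Data.Nat using (ℕ; zero; suc; _+_; _*_; _≤_; _≤?_; _≟_)
open import Data.List using (List; []; _∷_; map; concatMap; upTo; filter; length)
open import Data.Vec as Vec using (Vec)
open import Data.Product using (_×_)
open import Relation.Nullary using (Dec)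
open import Relation.Nullary.Decidable using (_×-dec_)

-- All integer vectors (x₁,…,xₙ) with 0 ≤ xᵢ ≤ q-1, as an explicit list
-- (each such vector occurs exactly once).
boxVecs : ℕ → (n : ℕ) → List (Vec ℕ n)
boxVecs q zero    = Vec.[] ∷ []
boxVecs q (suc n) = concatMap (λ x → map (x Vec.∷_) (boxVecs q n)) (upTo q)

zeros : ∀ {n} → Vec ℕ n → ℕ
zeros = Vec.count (_≟ 0)

InA : (n : ℕ) → Vec ℕ n → Set
InA n v = 100 * Vec.sum v ≤ 132 * n

inA? : (n : ℕ) → (v : Vec ℕ n) → Dec (InA n v)
inA? n v = 100 * Vec.sum v ≤? 132 * n

InB : (n : ℕ) → Vec ℕ n → Set
InB n v = 5657 * n ≤ 10000 * zeros v

inB? : (n : ℕ) → (v : Vec ℕ n) → Dec (InB n v)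
inB? n v = 5657 * n ≤? 10000 * zeros v

cardA : ℕ → ℕ → ℕ
cardA q n = length (filter (inA? n) (boxVecs q n))

cardAB : ℕ → ℕ → ℕ
cardAB q n = length (filter (λ v → inA? n v ×-dec inB? n v) (boxVecs q n))

{-# OPTIONS --safe #-}

-- Both counts are estimated by exponential tilting. For any weight f on digits, the total
-- weight ∏ᵢ f (xᵢ) of the box {0,…,q-1}ⁿ is (Σⱼ f j)ⁿ.
-- Upper bound: weight a digit j by (π / ρ)^(100 j), times a²⁵ if j = 0 and b²⁵ < a²⁵ otherwise.
-- Every vector of A ∩ B (digit sum ≤ 1.32 n, at least 0.56 n zeros) then weighs at least
-- (a¹⁴ b¹¹ (π / ρ)¹³²)ⁿ, so |A ∩ B| is at most the total weight divided by that.
-- Lower bound: weight j < m by (π / ρ)^(100 j). A vector whose digit sum is at least κ n / 100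
-- weighs at most (π / ρ)^(κ n), so the vectors of A in that range account for at most
-- |A| (π / ρ)^(κ n). Vectors with digit sum above 1.32 n, or below κ n / 100, are re-weighted
-- with a slightly larger π₁, or a slightly smaller π₂. This shows that their weight is
-- exponentially smaller than the total.
-- Explicit parameters, checked by evaluation, make the resulting ratio decay exponentially. For
-- q ≥ 7 one parameter set serves every q: the lower weight is cut off at m = 7, and the upper
-- total weight is bounded by a geometric series.
module Submission where

open import Defs
open import Data.Nat using (ℕ; zero; suc; _+_; _*_; _^_; _∸_; _≤_; _<_; _≤ᵇ_; z≤n; s≤s; NonZero; >-nonZero; >-nonZero⁻¹; _<?_; _≤?_)
open import Data.Nat.Properties
open import Data.Nat.Tactic.RingSolver using (solve-∀)
open import Data.Bool using (T)
open import Data.List using (List; []; _∷_; map; concatMap; upTo; applyUpTo; filter; length; _++_)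
open import Data.Vec as Vec using (Vec)
open import Data.Product using (∃; _×_; _,_; proj₁; proj₂)
open import Function using (_∘_)
open import Relation.Nullary using (¬_; yes; no; contradiction)
open import Relation.Nullary.Decidable using (_×-dec_)
open import Relation.Unary using (Decidable)
open import Relation.Binary.PropositionalEquality

sumBy : {A : Set} → (A → ℕ) → List A → ℕ
sumBy g []       = 0
sumBy g (x ∷ xs) = g x + sumBy g xs

module _ {A : Set} where

  sumBy-++ : (g : A → ℕ) (xs ys : List A) → sumBy g (xs ++ ys) ≡ sumBy g xs + sumBy g ys
  sumBy-++ g []       ys = refl
  sumBy-++ g (x ∷ xs) ys = trans (cong (g x +_) (sumBy-++ g xs ys)) (sym (+-assoc (g x) _ _))

  sumBy-cong : {g h : A → ℕ} → (∀ x → g x ≡ h x) → (xs : List A) → sumBy g xs ≡ sumBy h xs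
  sumBy-cong g≗h []       = refl
  sumBy-cong g≗h (x ∷ xs) = cong₂ _+_ (g≗h x) (sumBy-cong g≗h xs)

  sumBy-*ˡ : (c : ℕ) (g : A → ℕ) (xs : List A) → sumBy (λ x → c * g x) xs ≡ c * sumBy g xs
  sumBy-*ˡ c g []       = sym (*-zeroʳ c)
  sumBy-*ˡ c g (x ∷ xs) = trans (cong (c * g x +_) (sumBy-*ˡ c g xs)) (sym (*-distribˡ-+ c (g x) _))

  sumBy-*ʳ : (c : ℕ) (g : A → ℕ) (xs : List A) → sumBy (λ x → g x * c) xs ≡ sumBy g xs * c
  sumBy-*ʳ c g []       = refl
  sumBy-*ʳ c g (x ∷ xs) = trans (cong (g x * c +_) (sumBy-*ʳ c g xs)) (sym (*-distribʳ-+ c (g x) _))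

  sumBy-+ : (g h : A → ℕ) (xs : List A) → sumBy (λ x → g x + h x) xs ≡ sumBy g xs + sumBy h xs
  sumBy-+ g h []       = refl
  sumBy-+ g h (x ∷ xs) = trans (cong (g x + h x +_) (sumBy-+ g h xs)) (shuffle (g x) (h x) _ _)
    where
    shuffle : ∀ a b c d → a + b + (c + d) ≡ a + c + (b + d)
    shuffle = solve-∀

sumBy-map : {A B : Set} (g : B → ℕ) (f : A → B) (xs : List A) → sumBy g (map f xs) ≡ sumBy (g ∘ f) xs
sumBy-map g f []       = refl
sumBy-map g f (x ∷ xs) = cong (g (f x) +_) (sumBy-map g f xs)

sumBy-concatMap : {A B : Set} (g : B → ℕ) (f : A → List B) (xs : List A) →
                  sumBy g (concatMap f xs) ≡ sumBy (sumBy g ∘ f) xs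
sumBy-concatMap g f []       = refl
sumBy-concatMap g f (x ∷ xs) =
  trans (sumBy-++ g (f x) (concatMap f xs)) (cong (sumBy g (f x) +_) (sumBy-concatMap g f xs))

module _ {A : Set} {P : A → Set} (P? : Decidable P) where

  length-filter*≤sumBy : (g : A → ℕ) (c : ℕ) → (∀ x → P x → c ≤ g x) → (xs : List A) →
                         length (filter P? xs) * c ≤ sumBy g xs
  length-filter*≤sumBy g c c≤g []       = z≤n
  length-filter*≤sumBy g c c≤g (x ∷ xs) with P? x
  ... | yes px = +-mono-≤ (c≤g x px) (length-filter*≤sumBy g c c≤g xs)
  ... | no  _  = ≤-trans (length-filter*≤sumBy g c c≤g xs) (m≤n+m _ (g x))

  sumBy≤length-filter*+sumBy : (g h : A → ℕ) (c : ℕ) →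
    (∀ x → (P x → g x ≤ c + h x) × (¬ P x → g x ≤ h x)) → (xs : List A) →
    sumBy g xs ≤ length (filter P? xs) * c + sumBy h xs
  sumBy≤length-filter*+sumBy g h c g≤ []       = z≤n
  sumBy≤length-filter*+sumBy g h c g≤ (x ∷ xs) with P? x
  ... | yes px = ≤-trans (+-mono-≤ (proj₁ (g≤ x) px) (sumBy≤length-filter*+sumBy g h c g≤ xs))
                         (≤-reflexive (shuffle c (h x) (length (filter P? xs) * c) (sumBy h xs)))
    where
    shuffle : ∀ a b c d → a + b + (c + d) ≡ a + c + (b + d)
    shuffle = solve-∀
  ... | no ¬px = ≤-trans (+-mono-≤ (proj₂ (g≤ x) ¬px) (sumBy≤length-filter*+sumBy g h c g≤ xs))
                         (≤-reflexive (+-comm-middle (h x) (length (filter P? xs) * c) (sumBy h xs)))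
    where
    +-comm-middle : ∀ a b c → a + (b + c) ≡ b + (a + c)
    +-comm-middle = solve-∀

sumBelow : ℕ → (ℕ → ℕ) → ℕ
sumBelow q g = sumBy g (upTo q)

sumBy-applyUpTo : (g f : ℕ → ℕ) (q : ℕ) → sumBy g (applyUpTo f q) ≡ sumBelow q (g ∘ f)
sumBy-applyUpTo g f zero    = refl
sumBy-applyUpTo g f (suc q) = cong (g (f 0) +_)
  (trans (sumBy-applyUpTo g (f ∘ suc) q) (sym (sumBy-applyUpTo (g ∘ f) suc q)))

sumBelow-suc : (q : ℕ) (g : ℕ → ℕ) → sumBelow (suc q) g ≡ g 0 + sumBelow q (g ∘ suc)
sumBelow-suc q g = cong (g 0 +_) (sumBy-applyUpTo g suc q)

sumBelow-+ : (m k : ℕ) (g : ℕ → ℕ) → sumBelow (m + k) g ≡ sumBelow m g + sumBelow k (g ∘ (m +_))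
sumBelow-+ zero    k g = refl
sumBelow-+ (suc m) k g = begin
  sumBelow (suc (m + k)) g                                  ≡⟨ sumBelow-suc (m + k) g ⟩
  g 0 + sumBelow (m + k) (g ∘ suc)                          ≡⟨ cong (g 0 +_) (sumBelow-+ m k (g ∘ suc)) ⟩
  g 0 + (sumBelow m (g ∘ suc) + sumBelow k (g ∘ suc ∘ (m +_))) ≡⟨ sym (+-assoc (g 0) _ _) ⟩
  g 0 + sumBelow m (g ∘ suc) + sumBelow k (g ∘ (suc m +_))  ≡⟨ cong (_+ sumBelow k (g ∘ (suc m +_))) (sym (sumBelow-suc m g)) ⟩
  sumBelow (suc m) g + sumBelow k (g ∘ (suc m +_))          ∎
  where open ≡-Reasoning

sumBelow-0 : (k : ℕ) {g : ℕ → ℕ} → (∀ j → g j ≡ 0) → sumBelow k g ≡ 0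
sumBelow-0 zero    g≡0 = refl
sumBelow-0 (suc k) g≡0 = trans (sumBelow-suc k _) (cong₂ _+_ (g≡0 0) (sumBelow-0 k (g≡0 ∘ suc)))

prodBy : (ℕ → ℕ) → ∀ {n} → Vec ℕ n → ℕ
prodBy f Vec.[]       = 1
prodBy f (x Vec.∷ v) = f x * prodBy f v

sumBy-prodBy-boxVecs : (q : ℕ) (f : ℕ → ℕ) (n : ℕ) → sumBy (prodBy f) (boxVecs q n) ≡ sumBelow q f ^ n
sumBy-prodBy-boxVecs q f zero    = refl
sumBy-prodBy-boxVecs q f (suc n) = begin
  sumBy (prodBy f) (concatMap (λ x → map (x Vec.∷_) (boxVecs q n)) (upTo q))
    ≡⟨ sumBy-concatMap (prodBy f) _ (upTo q) ⟩
  sumBy (λ x → sumBy (prodBy f) (map (x Vec.∷_) (boxVecs q n))) (upTo q)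
    ≡⟨ sumBy-cong row (upTo q) ⟩
  sumBy (λ x → f x * sumBelow q f ^ n) (upTo q)
    ≡⟨ sumBy-*ʳ (sumBelow q f ^ n) f (upTo q) ⟩
  sumBelow q f * sumBelow q f ^ n ∎
  where
  open ≡-Reasoning
  row : ∀ x → sumBy (prodBy f) (map (x Vec.∷_) (boxVecs q n)) ≡ f x * sumBelow q f ^ n
  row x = begin
    sumBy (prodBy f) (map (x Vec.∷_) (boxVecs q n)) ≡⟨ sumBy-map (prodBy f) (x Vec.∷_) (boxVecs q n) ⟩
    sumBy (λ v → f x * prodBy f v) (boxVecs q n)    ≡⟨ sumBy-*ˡ (f x) (prodBy f) (boxVecs q n) ⟩
    f x * sumBy (prodBy f) (boxVecs q n)            ≡⟨ cong (f x *_) (sumBy-prodBy-boxVecs q f n) ⟩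
    f x * sumBelow q f ^ n                          ∎

prodBy-* : (f g : ℕ → ℕ) → ∀ {n} (v : Vec ℕ n) → prodBy f v * prodBy g v ≡ prodBy (λ j → f j * g j) v
prodBy-* f g Vec.[]       = refl
prodBy-* f g (x Vec.∷ v) =
  trans (interchange (f x) (g x) (prodBy f v) (prodBy g v)) (cong (f x * g x *_) (prodBy-* f g v))
  where
  interchange : ∀ a b c d → a * c * (b * d) ≡ a * b * (c * d)
  interchange = solve-∀

prodBy-mono : {f g : ℕ → ℕ} → (∀ j → f j ≤ g j) → ∀ {n} (v : Vec ℕ n) → prodBy f v ≤ prodBy g v
prodBy-mono f≤g Vec.[]       = ≤-refl
prodBy-mono f≤g (x Vec.∷ v) = *-mono-≤ (f≤g x) (prodBy-mono f≤g v)

prodBy-cong : {f g : ℕ → ℕ} → (∀ j → f j ≡ g j) → ∀ {n} (v : Vec ℕ n) → prodBy f v ≡ prodBy g v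
prodBy-cong f≗g Vec.[]       = refl
prodBy-cong f≗g (x Vec.∷ v) = cong₂ _*_ (f≗g x) (prodBy-cong f≗g v)

prodBy-^ : (x : ℕ) → ∀ {n} (v : Vec ℕ n) → prodBy (x ^_) v ≡ x ^ Vec.sum v
prodBy-^ x Vec.[]       = refl
prodBy-^ x (y Vec.∷ v) = trans (cong (x ^ y *_) (prodBy-^ x v)) (sym (^-distribˡ-+-* x y _))

prodBy-const : (c : ℕ) → ∀ {n} (v : Vec ℕ n) → prodBy (λ _ → c) v ≡ c ^ n
prodBy-const c Vec.[]       = refl
prodBy-const c (x Vec.∷ v) = cong (c *_) (prodBy-const c v)

prodBy-*-≤ : {f g h k : ℕ → ℕ} → (∀ j → f j * g j ≤ h j * k j) →
             ∀ {n} (v : Vec ℕ n) → prodBy f v * prodBy g v ≤ prodBy h v * prodBy k v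
prodBy-*-≤ {f} {g} {h} {k} le v = begin
  prodBy f v * prodBy g v         ≡⟨ prodBy-* f g v ⟩
  prodBy (λ j → f j * g j) v      ≤⟨ prodBy-mono le v ⟩
  prodBy (λ j → h j * k j) v      ≡⟨ sym (prodBy-* h k v) ⟩
  prodBy h v * prodBy k v         ∎
  where open ≤-Reasoning

prodBy-*-≡ : {f g h k : ℕ → ℕ} → (∀ j → f j * g j ≡ h j * k j) →
             ∀ {n} (v : Vec ℕ n) → prodBy f v * prodBy g v ≡ prodBy h v * prodBy k v
prodBy-*-≡ {f} {g} {h} {k} eq v =
  trans (prodBy-* f g v) (trans (prodBy-cong eq v) (sym (prodBy-* h k v)))

^-distribʳ-* : ∀ a b n → (a * b) ^ n ≡ a ^ n * b ^ n
^-distribʳ-* a b zero    = refl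
^-distribʳ-* a b (suc n) = trans (cong (a * b *_) (^-distribʳ-* a b n)) (interchange a b (a ^ n) (b ^ n))
  where
  interchange : ∀ a b c d → a * b * (c * d) ≡ a * c * (b * d)
  interchange = solve-∀

^-+-∸ : ∀ β {x y} → x ≤ y → β ^ y ≡ β ^ x * β ^ (y ∸ x)
^-+-∸ β {x} {y} x≤y = trans (cong (β ^_) (sym (m+[n∸m]≡n x≤y))) (^-distribˡ-+-* β x (y ∸ x))

≤-raise-exponent : ∀ {α β x y w w′} → α ≤ β → x ≤ y → w * α ^ x ≤ w′ * β ^ x → w * α ^ y ≤ w′ * β ^ y
≤-raise-exponent {α} {β} {x} {y} {w} {w′} α≤β x≤y le = begin
  w * α ^ y                ≡⟨ cong (w *_) (^-+-∸ α x≤y) ⟩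
  w * (α ^ x * α ^ d)      ≡⟨ sym (*-assoc w _ _) ⟩
  w * α ^ x * α ^ d        ≤⟨ *-mono-≤ le (^-monoˡ-≤ d α≤β) ⟩
  w′ * β ^ x * β ^ d       ≡⟨ *-assoc w′ _ _ ⟩
  w′ * (β ^ x * β ^ d)     ≡⟨ cong (w′ *_) (sym (^-+-∸ β x≤y)) ⟩
  w′ * β ^ y               ∎
  where
  open ≤-Reasoning
  d = y ∸ x

≤-lower-exponent : ∀ {α β x y w w′} .{{_ : NonZero β}} → α ≤ β → x ≤ y →
                   w * β ^ y ≤ w′ * α ^ y → w * β ^ x ≤ w′ * α ^ x
≤-lower-exponent {α} {β} {x} {y} {w} {w′} α≤β x≤y le = *-cancelʳ-≤ _ _ (β ^ d) {{m^n≢0 β d}} (begin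
  w * β ^ x * β ^ d        ≡⟨ *-assoc w _ _ ⟩
  w * (β ^ x * β ^ d)      ≡⟨ cong (w *_) (sym (^-+-∸ β x≤y)) ⟩
  w * β ^ y                ≤⟨ le ⟩
  w′ * α ^ y               ≡⟨ cong (w′ *_) (^-+-∸ α x≤y) ⟩
  w′ * (α ^ x * α ^ d)     ≡⟨ sym (*-assoc w′ _ _) ⟩
  w′ * α ^ x * α ^ d       ≤⟨ *-monoʳ-≤ (w′ * α ^ x) (^-monoˡ-≤ d α≤β) ⟩
  w′ * α ^ x * β ^ d       ∎)
  where
  open ≤-Reasoning
  d = y ∸ x

^-expand₃ : ∀ a b c k l r n → (a ^ k * b ^ l * c ^ r) ^ n ≡ a ^ (k * n) * b ^ (l * n) * c ^ (r * n)
^-expand₃ a b c k l r n = begin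
  (a ^ k * b ^ l * c ^ r) ^ n          ≡⟨ ^-distribʳ-* (a ^ k * b ^ l) (c ^ r) n ⟩
  (a ^ k * b ^ l) ^ n * (c ^ r) ^ n    ≡⟨ cong (_* (c ^ r) ^ n) (^-distribʳ-* (a ^ k) (b ^ l) n) ⟩
  (a ^ k) ^ n * (b ^ l) ^ n * (c ^ r) ^ n
    ≡⟨ cong₂ _*_ (cong₂ _*_ (^-*-assoc a k n) (^-*-assoc b l n)) (^-*-assoc c r n) ⟩
  a ^ (k * n) * b ^ (l * n) * c ^ (r * n) ∎
  where open ≡-Reasoning

*-^-rescale-≤ : ∀ {u K Y R S d g} n .{{_ : NonZero Y}} →
                u * (K * Y) ^ n ≤ (R * S) ^ n → d * S ≤ Y * g → u * (K * d) ^ n ≤ (R * g) ^ n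
*-^-rescale-≤ {u} {K} {Y} {R} {S} {d} {g} n le dS≤Yg = *-cancelʳ-≤ _ _ (Y ^ n) {{m^n≢0 Y n}} (begin
  u * (K * d) ^ n * Y ^ n          ≡⟨ cong (λ z → u * z * Y ^ n) (^-distribʳ-* K d n) ⟩
  u * (K ^ n * d ^ n) * Y ^ n      ≡⟨ regroup u (K ^ n) (d ^ n) (Y ^ n) ⟩
  u * (K ^ n * Y ^ n) * d ^ n      ≡⟨ cong (λ z → u * z * d ^ n) (sym (^-distribʳ-* K Y n)) ⟩
  u * (K * Y) ^ n * d ^ n          ≤⟨ *-monoˡ-≤ (d ^ n) le ⟩
  (R * S) ^ n * d ^ n              ≡⟨ sym (^-distribʳ-* (R * S) d n) ⟩
  (R * S * d) ^ n                  ≡⟨ cong (_^ n) (regroup′ R S d) ⟩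
  (R * (d * S)) ^ n                ≤⟨ ^-monoˡ-≤ n (*-monoʳ-≤ R dS≤Yg) ⟩
  (R * (Y * g)) ^ n                ≡⟨ cong (_^ n) (regroup″ R Y g) ⟩
  (R * g * Y) ^ n                  ≡⟨ ^-distribʳ-* (R * g) Y n ⟩
  (R * g) ^ n * Y ^ n              ∎)
  where
  open ≤-Reasoning
  regroup : ∀ u k d y → u * (k * d) * y ≡ u * (k * y) * d
  regroup = solve-∀
  regroup′ : ∀ r s d → r * s * d ≡ r * (d * s)
  regroup′ = solve-∀
  regroup″ : ∀ r y g → r * (y * g) ≡ r * g * y
  regroup″ = solve-∀

-- From exponential bounds to an exponentially small ratio

bernoulli : ∀ {x y} n → y < x → y ^ n * (y + n) ≤ y * x ^ n
bernoulli {x} {y} zero    y<x = ≤-reflexive (trans (*-identityˡ (y + 0)) (trans (+-identityʳ y) (sym (*-identityʳ y))))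
bernoulli {x} {y} (suc n) y<x = begin
  y * y ^ n * (y + suc n)           ≡⟨ expand y (y ^ n) n ⟩
  y * (y ^ n * (y + n)) + y * y ^ n ≤⟨ +-mono-≤ (*-monoʳ-≤ y (bernoulli n y<x))
                                                 (*-monoʳ-≤ y (^-monoˡ-≤ n (<⇒≤ y<x))) ⟩
  y * (y * x ^ n) + y * x ^ n       ≡⟨ collect y (x ^ n) ⟩
  y * (suc y * x ^ n)               ≤⟨ *-monoʳ-≤ y (*-monoˡ-≤ (x ^ n) y<x) ⟩
  y * (x * x ^ n)                   ∎
  where
  open ≤-Reasoning
  expand : ∀ y p n → y * p * (y + suc n) ≡ y * (p * (y + n)) + y * p
  expand = solve-∀
  collect : ∀ y p → y * (y * p) + y * p ≡ y * (suc y * p)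
  collect = solve-∀

4*y^n≤x^n : ∀ {x y n} → y < x → 3 * y < n → 4 * y ^ n ≤ x ^ n
4*y^n≤x^n {x} {zero}  {suc n} _   _    = z≤n
4*y^n≤x^n {x} {suc y} {n}     y<x 3y<n = *-cancelˡ-≤ (suc y) (begin
  suc y * (4 * p)          ≡⟨ regroup (suc y) p ⟩
  p * (suc y + 3 * suc y)  ≤⟨ *-monoʳ-≤ p (+-monoʳ-≤ (suc y) (<⇒≤ 3y<n)) ⟩
  p * (suc y + n)          ≤⟨ bernoulli n y<x ⟩
  suc y * x ^ n            ∎)
  where
  open ≤-Reasoning
  p = suc y ^ n
  regroup : ∀ a p → a * (4 * p) ≡ p * (a + 3 * a)
  regroup = solve-∀

≤-absorb-small : ∀ {x w y z} → x ≤ w + (y + z) → 4 * y ≤ x → 4 * z ≤ x → x ≤ 2 * w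
≤-absorb-small {x} {w} {y} {z} x≤ 4y≤x 4z≤x = *-cancelˡ-≤ 2 (+-cancelʳ-≤ (2 * x) (2 * x) (2 * (2 * w)) (begin
  2 * x + 2 * x            ≡⟨ double x ⟩
  4 * x                    ≤⟨ *-monoʳ-≤ 4 x≤ ⟩
  4 * (w + (y + z))        ≡⟨ expand w y z ⟩
  4 * w + (4 * y + 4 * z)  ≤⟨ +-monoʳ-≤ (4 * w) (+-mono-≤ 4y≤x 4z≤x) ⟩
  4 * w + (x + x)          ≡⟨ regroup w x ⟩
  2 * (2 * w) + 2 * x      ∎))
  where
  open ≤-Reasoning
  double : ∀ x → 2 * x + 2 * x ≡ 4 * x
  double = solve-∀
  expand : ∀ w y z → 4 * (w + (y + z)) ≡ 4 * w + (4 * y + 4 * z)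
  expand = solve-∀
  regroup : ∀ w x → 4 * w + (x + x) ≡ 2 * (2 * w) + 2 * x
  regroup = solve-∀

ExponentiallySmaller : (ℕ → ℕ) → (ℕ → ℕ) → Set
ExponentiallySmaller u v =
  ∃ λ a → ∃ λ b → 1 ≤ b × b < a × ∃ λ N → ∀ n → N ≤ n → 1 ≤ n → u n * a ^ n < v n * b ^ n

-- Once X₁ⁿ and X₂ⁿ are negligible, v n ≥ (X₀ / Y)ⁿ / 2, so u n / v n ≤ 2 (G Y / (M X₀))ⁿ;
-- taking b = G Y + 1 absorbs the factor 2.
exponentialRatioBound : (u v : ℕ → ℕ) (M G X₀ Y X₁ X₂ : ℕ) →
  (∀ n → u n * M ^ n ≤ G ^ n) →
  (∀ n → X₀ ^ n ≤ v n * Y ^ n + (X₁ ^ n + X₂ ^ n)) →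
  X₁ < X₀ → X₂ < X₀ → 1 ≤ G → suc (G * Y) < M * X₀ →
  ExponentiallySmaller u v
exponentialRatioBound u v M G X₀ Y X₁ X₂ upper lower X₁<X₀ X₂<X₀ 1≤G b<a =
  M * X₀ , suc (G * Y) , s≤s z≤n , b<a , N , bound
  where
  N = suc (3 * (X₁ + X₂ + G * Y))
  bound : ∀ n → N ≤ n → 1 ≤ n → u n * (M * X₀) ^ n < v n * suc (G * Y) ^ n
  bound n N≤n _ = begin-strict
    u n * (M * X₀) ^ n             ≡⟨ cong (u n *_) (^-distribʳ-* M X₀ n) ⟩
    u n * (M ^ n * X₀ ^ n)         ≡⟨ sym (*-assoc (u n) _ _) ⟩
    u n * M ^ n * X₀ ^ n           ≤⟨ *-monoˡ-≤ (X₀ ^ n) (upper n) ⟩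
    G ^ n * X₀ ^ n                 <⟨ m<m+n (G ^ n * X₀ ^ n) positive ⟩
    G ^ n * X₀ ^ n + G ^ n * X₀ ^ n ≤⟨ +-mono-≤ (*-monoʳ-≤ (G ^ n) leading) (*-monoʳ-≤ (G ^ n) leading) ⟩
    G ^ n * W + G ^ n * W          ≡⟨ regroup (G ^ n) (v n) (Y ^ n) ⟩
    v n * (4 * (G ^ n * Y ^ n))    ≡⟨ cong (λ z → v n * (4 * z)) (sym (^-distribʳ-* G Y n)) ⟩
    v n * (4 * (G * Y) ^ n)        ≤⟨ *-monoʳ-≤ (v n) (4*y^n≤x^n ≤-refl (3[x]<N (m≤n+m (G * Y) _))) ⟩
    v n * suc (G * Y) ^ n          ∎
    where
    open ≤-Reasoning
    W = 2 * (v n * Y ^ n)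
    3[x]<N : ∀ {x} → x ≤ X₁ + X₂ + G * Y → 3 * x < n
    3[x]<N x≤ = ≤-trans (s≤s (*-monoʳ-≤ 3 x≤)) N≤n
    leading : X₀ ^ n ≤ W
    leading = ≤-absorb-small {w = v n * Y ^ n} {X₁ ^ n} {X₂ ^ n} (lower n)
      (4*y^n≤x^n X₁<X₀ (3[x]<N (≤-trans (m≤m+n X₁ X₂) (m≤m+n _ (G * Y)))))
      (4*y^n≤x^n X₂<X₀ (3[x]<N (≤-trans (m≤n+m X₂ X₁) (m≤m+n _ (G * Y)))))
    positive : 0 < G ^ n * X₀ ^ n
    positive = *-mono-< (m^n>0 G {{>-nonZero 1≤G}} n) (m^n>0 X₀ {{>-nonZero (≤-<-trans z≤n X₁<X₀)}} n)
    regroup : ∀ g v y → g * (2 * (v * y)) + g * (2 * (v * y)) ≡ v * (4 * (g * y))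
    regroup = solve-∀

-- y ^ (q - 1) * (x / y) ^ j kept integral; for j ≥ q the truncated subtraction leaves x ^ j.
geomWeight : ℕ → ℕ → ℕ → ℕ → ℕ
geomWeight q x y j = x ^ j * y ^ (q ∸ suc j)

geomWeight-tilt : ∀ q x y z j → geomWeight q x y j * z ^ j ≡ geomWeight q z y j * x ^ j
geomWeight-tilt q x y z j = swap (x ^ j) (z ^ j) (y ^ (q ∸ suc j))
  where
  swap : ∀ a b c → a * c * b ≡ b * c * a
  swap = solve-∀

geomWeight-*-^ : ∀ q x y j → geomWeight q x y j * y ^ j ≡ x ^ j * y ^ (q ∸ suc j + j)
geomWeight-*-^ q x y j = begin
  x ^ j * y ^ (q ∸ suc j) * y ^ j  ≡⟨ *-assoc (x ^ j) _ _ ⟩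
  x ^ j * (y ^ (q ∸ suc j) * y ^ j) ≡⟨ cong (x ^ j *_) (sym (^-distribˡ-+-* y (q ∸ suc j) j)) ⟩
  x ^ j * y ^ (q ∸ suc j + j)      ∎
  where open ≡-Reasoning

q∸1≤q∸[1+j]+j : ∀ q j → q ∸ 1 ≤ q ∸ suc j + j
q∸1≤q∸[1+j]+j q j = ≤-trans (m≤n+m∸n (q ∸ 1) j)
  (≤-reflexive (trans (cong (j +_) (∸-+-assoc q 1 j)) (+-comm j _)))

geomWeight-*-^-≥ : ∀ q x y j .{{_ : NonZero y}} → x ^ j * y ^ (q ∸ 1) ≤ geomWeight q x y j * y ^ j
geomWeight-*-^-≥ q x y j = begin
  x ^ j * y ^ (q ∸ 1)             ≤⟨ *-monoʳ-≤ (x ^ j) (^-monoʳ-≤ y (q∸1≤q∸[1+j]+j q j)) ⟩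
  x ^ j * y ^ (q ∸ suc j + j)     ≡⟨ sym (geomWeight-*-^ q x y j) ⟩
  geomWeight q x y j * y ^ j      ∎
  where open ≤-Reasoning

geomWeight-suc : ∀ q x y j → geomWeight (suc q) x y (suc j) ≡ x * geomWeight q x y j
geomWeight-suc q x y j = *-assoc x (x ^ j) (y ^ (q ∸ suc j))

sumBelow-geomWeight-suc : ∀ q x y → sumBelow q (geomWeight (suc q) x y ∘ suc) ≡ x * sumBelow q (geomWeight q x y)
sumBelow-geomWeight-suc q x y =
  trans (sumBy-cong (geomWeight-suc q x y) (upTo q)) (sumBy-*ˡ x (geomWeight q x y) (upTo q))

-- (y - x) (y ^ (q - 1) + x y ^ (q - 2) + ⋯ + x ^ (q - 1)) = y ^ q - x ^ q
sumBelow-geomWeight-≤ : ∀ {d x y} → d + x ≡ y → ∀ q → d * sumBelow q (geomWeight q x y) ≤ y ^ q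
sumBelow-geomWeight-≤ {d} e zero    = ≤-trans (≤-reflexive (*-zeroʳ d)) z≤n
sumBelow-geomWeight-≤ {d} {x} {y} e (suc q) = begin
  d * sumBelow (suc q) (geomWeight (suc q) x y)  ≡⟨ cong (d *_) (sumBelow-suc q _) ⟩
  d * (1 * y ^ q + sumBelow q (geomWeight (suc q) x y ∘ suc))
                                                 ≡⟨ cong (λ z → d * (1 * y ^ q + z)) (sumBelow-geomWeight-suc q x y) ⟩
  d * (1 * y ^ q + x * S)                        ≡⟨ expand d x (y ^ q) S ⟩
  d * y ^ q + x * (d * S)                        ≤⟨ +-monoʳ-≤ (d * y ^ q) (*-monoʳ-≤ x (sumBelow-geomWeight-≤ {d} {x} e q)) ⟩
  d * y ^ q + x * y ^ q                          ≡⟨ sym (*-distribʳ-+ (y ^ q) d x) ⟩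
  (d + x) * y ^ q                                ≡⟨ cong (_* y ^ q) e ⟩
  y * y ^ q                                      ∎
  where
  open ≤-Reasoning
  S = sumBelow q (geomWeight q x y)
  expand : ∀ d x p s → d * (1 * p + x * s) ≡ d * p + x * (d * s)
  expand = solve-∀

zeroOr : ℕ → ℕ → ℕ → ℕ
zeroOr A B zero    = A
zeroOr A B (suc _) = B

prodBy-zeroOr : ∀ A B {n} (v : Vec ℕ n) → prodBy (zeroOr A B) v * B ^ zeros v ≡ A ^ zeros v * B ^ n
prodBy-zeroOr A B Vec.[]             = refl
prodBy-zeroOr A B {suc n} (zero Vec.∷ v) = begin
  A * P * (B * B ^ zeros v)   ≡⟨ regroup A B P (B ^ zeros v) ⟩
  A * (P * B ^ zeros v) * B   ≡⟨ cong (λ z → A * z * B) (prodBy-zeroOr A B v) ⟩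
  A * (A ^ zeros v * B ^ n) * B ≡⟨ regroup′ A B (A ^ zeros v) (B ^ n) ⟩
  A * A ^ zeros v * (B * B ^ n) ∎
  where
  open ≡-Reasoning
  P = prodBy (zeroOr A B) v
  regroup : ∀ a b p c → a * p * (b * c) ≡ a * (p * c) * b
  regroup = solve-∀
  regroup′ : ∀ a b c d → a * (c * d) * b ≡ a * c * (b * d)
  regroup′ = solve-∀
prodBy-zeroOr A B {suc n} (suc x Vec.∷ v) = begin
  B * P * B ^ zeros v           ≡⟨ *-assoc B P _ ⟩
  B * (P * B ^ zeros v)         ≡⟨ cong (B *_) (prodBy-zeroOr A B v) ⟩
  B * (A ^ zeros v * B ^ n)     ≡⟨ swap B (A ^ zeros v) (B ^ n) ⟩
  A ^ zeros v * (B * B ^ n)     ∎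
  where
  open ≡-Reasoning
  P = prodBy (zeroOr A B) v
  swap : ∀ a b c → a * (b * c) ≡ b * (a * c)
  swap = solve-∀

prodBy-zeroOr-≥ : ∀ {a b} k l .{{_ : NonZero b}} → b ≤ a → ∀ {n} (v : Vec ℕ n) →
                  k * n ≤ (k + l) * zeros v →
                  (a ^ k * b ^ l) ^ n ≤ prodBy (zeroOr (a ^ (k + l)) (b ^ (k + l))) v
prodBy-zeroOr-≥ {a} {b} k l b≤a {n} v kn≤mZ = *-cancelˡ-≤ (b ^ (k * n)) {{m^n≢0 b (k * n)}} (begin
  b ^ (k * n) * (a ^ k * b ^ l) ^ n            ≡⟨ cong (b ^ (k * n) *_) (^-distribʳ-* (a ^ k) (b ^ l) n) ⟩
  b ^ (k * n) * ((a ^ k) ^ n * (b ^ l) ^ n)    ≡⟨ cong₂ (λ x y → b ^ (k * n) * (x * y)) (^-*-assoc a k n) (^-*-assoc b l n) ⟩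
  b ^ (k * n) * (a ^ (k * n) * b ^ (l * n))    ≡⟨ regroup (b ^ (k * n)) (a ^ (k * n)) (b ^ (l * n)) ⟩
  b ^ (k * n) * b ^ (l * n) * a ^ (k * n)      ≡⟨ cong (_* a ^ (k * n)) (sym (^-distribˡ-+-* b (k * n) (l * n))) ⟩
  b ^ (k * n + l * n) * a ^ (k * n)            ≡⟨ cong (λ e → b ^ e * a ^ (k * n)) (sym (*-distribʳ-+ n k l)) ⟩
  b ^ (m * n) * a ^ (k * n)                    ≤⟨ ≤-lower-exponent {w = b ^ (m * n)} {P} {{a≢0}} b≤a kn≤mZ (≤-reflexive tilted) ⟩
  P * b ^ (k * n)                              ≡⟨ *-comm P _ ⟩
  b ^ (k * n) * P                              ∎)
  where
  open ≤-Reasoning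
  m = k + l
  P = prodBy (zeroOr (a ^ m) (b ^ m)) v
  Z = zeros v
  a≢0 : NonZero a
  a≢0 = >-nonZero (≤-trans (>-nonZero⁻¹ b) b≤a)
  regroup : ∀ x y z → x * (y * z) ≡ x * z * y
  regroup = solve-∀
  tilted : b ^ (m * n) * a ^ (m * Z) ≡ P * b ^ (m * Z)
  tilted = begin-equality
    b ^ (m * n) * a ^ (m * Z)      ≡⟨ sym (cong₂ _*_ (^-*-assoc b m n) (^-*-assoc a m Z)) ⟩
    (b ^ m) ^ n * (a ^ m) ^ Z      ≡⟨ *-comm ((b ^ m) ^ n) _ ⟩
    (a ^ m) ^ Z * (b ^ m) ^ n      ≡⟨ sym (prodBy-zeroOr (a ^ m) (b ^ m) v) ⟩
    P * (b ^ m) ^ Z                ≡⟨ cong (P *_) (^-*-assoc b m Z) ⟩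
    P * b ^ (m * Z)                ∎

prodBy-geomWeight-≥ : ∀ {π ρ} e t q .{{_ : NonZero ρ}} → π ≤ ρ → ∀ {n} (v : Vec ℕ n) →
                      e * Vec.sum v ≤ t * n →
                      (π ^ t * (ρ ^ e) ^ (q ∸ 1)) ^ n ≤ (ρ ^ t) ^ n * prodBy (geomWeight q (π ^ e) (ρ ^ e)) v
prodBy-geomWeight-≥ {π} {ρ} e t q π≤ρ {n} v es≤tn = begin
  (π ^ t * (ρ ^ e) ^ (q ∸ 1)) ^ n   ≡⟨ ^-distribʳ-* (π ^ t) _ n ⟩
  (π ^ t) ^ n * c                   ≡⟨ cong (_* c) (^-*-assoc π t n) ⟩
  π ^ (t * n) * c                   ≡⟨ *-comm _ c ⟩
  c * π ^ (t * n)                   ≤⟨ ≤-raise-exponent {w = c} {P} π≤ρ es≤tn tilted ⟩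
  P * ρ ^ (t * n)                   ≡⟨ cong (P *_) (sym (^-*-assoc ρ t n)) ⟩
  P * (ρ ^ t) ^ n                   ≡⟨ *-comm P _ ⟩
  (ρ ^ t) ^ n * P                   ∎
  where
  open ≤-Reasoning
  s = Vec.sum v
  c = ((ρ ^ e) ^ (q ∸ 1)) ^ n
  P = prodBy (geomWeight q (π ^ e) (ρ ^ e)) v
  tilted : c * π ^ (e * s) ≤ P * ρ ^ (e * s)
  tilted = begin
    c * π ^ (e * s)                           ≡⟨ cong (c *_) (sym (^-*-assoc π e s)) ⟩
    c * (π ^ e) ^ s                           ≡⟨ *-comm c _ ⟩
    (π ^ e) ^ s * c                           ≡⟨ sym (cong₂ _*_ (prodBy-^ (π ^ e) v) (prodBy-const _ v)) ⟩
    prodBy ((π ^ e) ^_) v * prodBy (λ _ → (ρ ^ e) ^ (q ∸ 1)) v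
      ≤⟨ prodBy-*-≤ (λ j → geomWeight-*-^-≥ q (π ^ e) (ρ ^ e) j {{m^n≢0 ρ e}}) v ⟩
    P * prodBy ((ρ ^ e) ^_) v                 ≡⟨ cong (P *_) (prodBy-^ (ρ ^ e) v) ⟩
    P * (ρ ^ e) ^ s                           ≡⟨ cong (P *_) (^-*-assoc ρ e s) ⟩
    P * ρ ^ (e * s)                           ∎

-- Counting A ∩ B from above

abWeight : (q A B x y : ℕ) → ℕ → ℕ
abWeight q A B x y j = zeroOr A B j * geomWeight q x y j

sumBelow-abWeight-≤ : ∀ {d x y} → d + x ≡ y → ∀ A B q →
  d * sumBelow q (abWeight q A B x y) ≤ y ^ (q ∸ 1) * (A * d + B * x)
sumBelow-abWeight-≤ {d} e A B zero    = ≤-trans (≤-reflexive (*-zeroʳ d)) z≤n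
sumBelow-abWeight-≤ {d} {x} {y} e A B (suc q) = begin
  d * sumBelow (suc q) (abWeight (suc q) A B x y) ≡⟨ cong (d *_) (sumBelow-suc q _) ⟩
  d * (A * (1 * y ^ q) + sumBelow q (λ j → B * geomWeight (suc q) x y (suc j)))
    ≡⟨ cong (λ z → d * (A * (1 * y ^ q) + z)) (sumBy-*ˡ B _ (upTo q)) ⟩
  d * (A * (1 * y ^ q) + B * sumBelow q (geomWeight (suc q) x y ∘ suc))
    ≡⟨ cong (λ z → d * (A * (1 * y ^ q) + B * z)) (sumBelow-geomWeight-suc q x y) ⟩
  d * (A * (1 * y ^ q) + B * (x * S))             ≡⟨ expand d A B x (y ^ q) S ⟩
  y ^ q * (A * d) + B * x * (d * S)              ≤⟨ +-monoʳ-≤ (y ^ q * (A * d)) (*-monoʳ-≤ (B * x) (sumBelow-geomWeight-≤ {d} {x} e q)) ⟩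
  y ^ q * (A * d) + B * x * y ^ q                ≡⟨ collect (y ^ q) (A * d) (B * x) ⟩
  y ^ q * (A * d + B * x)                        ∎
  where
  open ≤-Reasoning
  S = sumBelow q (geomWeight q x y)
  expand : ∀ d A B x p s → d * (A * (1 * p) + B * (x * s)) ≡ p * (A * d) + B * x * (d * s)
  expand = solve-∀
  collect : ∀ p a b → p * a + b * p ≡ p * (a + b)
  collect = solve-∀

module UpperBound (a b π ρ : ℕ) where

  M G : ℕ → ℕ
  M q = a ^ 14 * b ^ 11 * π ^ 132 * (ρ ^ 100) ^ (q ∸ 1)
  G q = ρ ^ 132 * sumBelow q (abWeight q (a ^ 25) (b ^ 25) (π ^ 100) (ρ ^ 100))

  M′ G′ : ℕ → ℕ
  M′ d = a ^ 14 * b ^ 11 * π ^ 132 * d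
  G′ d = ρ ^ 132 * (a ^ 25 * d + b ^ 25 * π ^ 100)

  module _ .{{_ : NonZero b}} .{{_ : NonZero ρ}} (b≤a : b ≤ a) (π≤ρ : π ≤ ρ) where

    prodBy-abWeight-≥ : ∀ q {n} (v : Vec ℕ n) → InA n v × InB n v →
      M q ^ n ≤ (ρ ^ 132) ^ n * prodBy (abWeight q (a ^ 25) (b ^ 25) (π ^ 100) (ρ ^ 100)) v
    prodBy-abWeight-≥ q {n} v (inA , inB) = begin
      (a ^ 14 * b ^ 11 * π ^ 132 * (ρ ^ 100) ^ (q ∸ 1)) ^ n
        ≡⟨ cong (_^ n) (*-assoc (a ^ 14 * b ^ 11) (π ^ 132) _) ⟩
      (a ^ 14 * b ^ 11 * (π ^ 132 * (ρ ^ 100) ^ (q ∸ 1))) ^ n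
        ≡⟨ ^-distribʳ-* (a ^ 14 * b ^ 11) _ n ⟩
      (a ^ 14 * b ^ 11) ^ n * (π ^ 132 * (ρ ^ 100) ^ (q ∸ 1)) ^ n
        ≤⟨ *-mono-≤ (prodBy-zeroOr-≥ 14 11 b≤a v 14n≤25zeros) (prodBy-geomWeight-≥ 100 132 q π≤ρ v inA) ⟩
      Pz * ((ρ ^ 132) ^ n * Pg)   ≡⟨ swap Pz ((ρ ^ 132) ^ n) Pg ⟩
      (ρ ^ 132) ^ n * (Pz * Pg)   ≡⟨ cong ((ρ ^ 132) ^ n *_) (prodBy-* _ _ v) ⟩
      (ρ ^ 132) ^ n * prodBy (abWeight q (a ^ 25) (b ^ 25) (π ^ 100) (ρ ^ 100)) v ∎
      where
      open ≤-Reasoning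
      Pz = prodBy (zeroOr (a ^ 25) (b ^ 25)) v
      Pg = prodBy (geomWeight q (π ^ 100) (ρ ^ 100)) v
      swap : ∀ a b c → a * (b * c) ≡ b * (a * c)
      swap = solve-∀
      -- 14 / 25 = 0.56 ≤ 0.5657
      14n≤25zeros : 14 * n ≤ 25 * zeros v
      14n≤25zeros = *-cancelˡ-≤ 400 (begin
        400 * (14 * n)        ≡⟨ sym (*-assoc 400 14 n) ⟩
        5600 * n              ≤⟨ *-monoˡ-≤ n (≤ᵇ⇒≤ 5600 5657 _) ⟩
        5657 * n              ≤⟨ inB ⟩
        10000 * zeros v       ≡⟨ *-assoc 400 25 (zeros v) ⟩
        400 * (25 * zeros v)  ∎)

    cardAB-upper : ∀ q n → cardAB q n * M q ^ n ≤ G q ^ n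
    cardAB-upper q n = begin
      cardAB q n * M q ^ n
        ≤⟨ length-filter*≤sumBy (λ v → inA? n v ×-dec inB? n v) (λ v → (ρ ^ 132) ^ n * prodBy f v) _
                                (prodBy-abWeight-≥ q) (boxVecs q n) ⟩
      sumBy (λ v → (ρ ^ 132) ^ n * prodBy f v) (boxVecs q n)
        ≡⟨ sumBy-*ˡ ((ρ ^ 132) ^ n) (prodBy f) (boxVecs q n) ⟩
      (ρ ^ 132) ^ n * sumBy (prodBy f) (boxVecs q n)
        ≡⟨ cong ((ρ ^ 132) ^ n *_) (sumBy-prodBy-boxVecs q f n) ⟩
      (ρ ^ 132) ^ n * sumBelow q f ^ n
        ≡⟨ sym (^-distribʳ-* (ρ ^ 132) _ n) ⟩
      G q ^ n ∎
      where
      open ≤-Reasoning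
      f = abWeight q (a ^ 25) (b ^ 25) (π ^ 100) (ρ ^ 100)

    cardAB-upper-uniform : ∀ {d} → d + π ^ 100 ≡ ρ ^ 100 → ∀ q n → cardAB q n * M′ d ^ n ≤ G′ d ^ n
    cardAB-upper-uniform {d} d+π¹⁰⁰≡ρ¹⁰⁰ q n =
      *-^-rescale-≤ {cardAB q n} {a ^ 14 * b ^ 11 * π ^ 132} {R = ρ ^ 132} n {{m^n≢0 (ρ ^ 100) (q ∸ 1) {{m^n≢0 ρ 100}}}}
        (cardAB-upper q n) (sumBelow-abWeight-≤ {d} {π ^ 100} d+π¹⁰⁰≡ρ¹⁰⁰ (a ^ 25) (b ^ 25) q)

-- Counting A from below

lowWeight : ℕ → ℕ → ℕ → ℕ → ℕ
lowWeight m x y j with j <? m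
... | yes _ = geomWeight m x y j
... | no  _ = 0

lowWeight-tilt : ∀ m x y z j → lowWeight m x y j * z ^ j ≡ lowWeight m z y j * x ^ j
lowWeight-tilt m x y z j with j <? m
... | yes _ = geomWeight-tilt m x y z j
... | no  _ = refl

lowWeight-*-^-≤ : ∀ m x y j → lowWeight m x y j * y ^ j ≤ x ^ j * y ^ (m ∸ 1)
lowWeight-*-^-≤ m x y j with j <? m
... | yes j<m = ≤-reflexive (trans (geomWeight-*-^ m x y j) (cong (λ e → x ^ j * y ^ e) m∸[1+j]+j≡m∸1))
  where
  m∸[1+j]+j≡m∸1 : m ∸ suc j + j ≡ m ∸ 1
  m∸[1+j]+j≡m∸1 = trans (cong (_+ j) (sym (∸-+-assoc m 1 j))) (m∸n+n≡m (<⇒≤pred j<m))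
... | no  _   = z≤n

lowWeight-≥ : ∀ m x y j → m ≤ j → lowWeight m x y j ≡ 0
lowWeight-≥ m x y j m≤j with j <? m
... | yes j<m = contradiction j<m (≤⇒≯ m≤j)
... | no  _   = refl

sumBelow-lowWeight : ∀ {m q} x y → m ≤ q → sumBelow q (lowWeight m x y) ≡ sumBelow m (lowWeight m x y)
sumBelow-lowWeight {m} {q} x y m≤q = begin
  sumBelow q g                                  ≡⟨ cong (λ r → sumBelow r g) (sym (m+[n∸m]≡n m≤q)) ⟩
  sumBelow (m + (q ∸ m)) g                      ≡⟨ sumBelow-+ m (q ∸ m) g ⟩
  sumBelow m g + sumBelow (q ∸ m) (g ∘ (m +_))  ≡⟨ cong (sumBelow m g +_) (sumBelow-0 (q ∸ m) (λ j → lowWeight-≥ m x y (m + j) (m≤m+n m j))) ⟩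
  sumBelow m g + 0                              ≡⟨ +-identityʳ _ ⟩
  sumBelow m g                                  ∎
  where
  open ≡-Reasoning
  g = lowWeight m x y

module LowerBound (m π π₁ π₂ ρ κ : ℕ) where

  W : ℕ → ∀ {n} → Vec ℕ n → ℕ
  W x = prodBy (lowWeight m (x ^ 100) (ρ ^ 100))

  F : ℕ → ℕ
  F x = sumBelow m (lowWeight m (x ^ 100) (ρ ^ 100))

  E D D₁ D₂ : ℕ
  E  = (ρ ^ 100) ^ (m ∸ 1)
  D  = ρ ^ κ * π₁ ^ 132 * π₂ ^ κ
  D₁ = π ^ 132 * ρ ^ κ * π₂ ^ κ
  D₂ = π ^ κ * ρ ^ κ * π₁ ^ 132

  X₀ Y X₁ X₂ : ℕ
  X₀ = F π * D
  Y  = π ^ κ * π₁ ^ 132 * π₂ ^ κ * E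
  X₁ = F π₁ * D₁
  X₂ = F π₂ * D₂

  W-tilt : ∀ x z {n} (v : Vec ℕ n) → W x v * z ^ (100 * Vec.sum v) ≡ W z v * x ^ (100 * Vec.sum v)
  W-tilt x z v = begin
    W x v * z ^ (100 * s)                ≡⟨ cong (W x v *_) (sym (^-*-assoc z 100 s)) ⟩
    W x v * (z ^ 100) ^ s                ≡⟨ cong (W x v *_) (sym (prodBy-^ (z ^ 100) v)) ⟩
    W x v * prodBy ((z ^ 100) ^_) v      ≡⟨ prodBy-*-≡ (lowWeight-tilt m (x ^ 100) (ρ ^ 100) (z ^ 100)) v ⟩
    W z v * prodBy ((x ^ 100) ^_) v      ≡⟨ cong (W z v *_) (prodBy-^ (x ^ 100) v) ⟩
    W z v * (x ^ 100) ^ s                ≡⟨ cong (W z v *_) (^-*-assoc x 100 s) ⟩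
    W z v * x ^ (100 * s)                ∎
    where
    open ≡-Reasoning
    s = Vec.sum v

  W-≤ : ∀ {n} (v : Vec ℕ n) → W π v * ρ ^ (100 * Vec.sum v) ≤ E ^ n * π ^ (100 * Vec.sum v)
  W-≤ {n} v = begin
    W π v * ρ ^ (100 * s)                ≡⟨ cong (W π v *_) (sym (^-*-assoc ρ 100 s)) ⟩
    W π v * (ρ ^ 100) ^ s                ≡⟨ cong (W π v *_) (sym (prodBy-^ (ρ ^ 100) v)) ⟩
    W π v * prodBy ((ρ ^ 100) ^_) v      ≤⟨ prodBy-*-≤ (lowWeight-*-^-≤ m (π ^ 100) (ρ ^ 100)) v ⟩
    prodBy ((π ^ 100) ^_) v * prodBy (λ _ → E) v ≡⟨ cong₂ _*_ (prodBy-^ (π ^ 100) v) (prodBy-const E v) ⟩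
    (π ^ 100) ^ s * E ^ n                ≡⟨ cong (_* E ^ n) (^-*-assoc π 100 s) ⟩
    π ^ (100 * s) * E ^ n                ≡⟨ *-comm _ (E ^ n) ⟩
    E ^ n * π ^ (100 * s)                ∎
    where
    open ≤-Reasoning
    s = Vec.sum v

  private
    module Atoms (n : ℕ) where
      R Q₁ Q₂ P P′ : ℕ
      R  = ρ ^ (κ * n)
      Q₁ = π₁ ^ (132 * n)
      Q₂ = π₂ ^ (κ * n)
      P  = π ^ (κ * n)
      P′ = π ^ (132 * n)

    reassoc : ∀ w p r a → w * p * (r * a) ≡ w * (p * r * a)
    reassoc = solve-∀


  small-sum : π₂ ≤ π → ∀ {n} (v : Vec ℕ n) → 100 * Vec.sum v ≤ κ * n → W π v * D ^ n ≤ W π₂ v * D₂ ^ n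
  small-sum π₂≤π {n} v le = begin
    W π v * D ^ n              ≡⟨ cong (W π v *_) (^-expand₃ ρ π₁ π₂ κ 132 κ n) ⟩
    W π v * (R * Q₁ * Q₂)      ≡⟨ rotate (W π v) R Q₁ Q₂ ⟩
    W π v * Q₂ * (R * Q₁)      ≤⟨ *-monoˡ-≤ (R * Q₁) tilted ⟩
    W π₂ v * P * (R * Q₁)      ≡⟨ reassoc (W π₂ v) P R Q₁ ⟩
    W π₂ v * (P * R * Q₁)      ≡⟨ cong (W π₂ v *_) (sym (^-expand₃ π ρ π₁ κ κ 132 n)) ⟩
    W π₂ v * D₂ ^ n            ∎
    where
    open ≤-Reasoning
    open Atoms n
    tilted : W π v * Q₂ ≤ W π₂ v * P
    tilted = ≤-raise-exponent {w = W π v} {W π₂ v} π₂≤π le (≤-reflexive (W-tilt π π₂ v))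
    rotate : ∀ w r a b → w * (r * a * b) ≡ w * b * (r * a)
    rotate = solve-∀

  moderate-sum : .{{_ : NonZero ρ}} → π ≤ ρ → ∀ {n} (v : Vec ℕ n) → κ * n ≤ 100 * Vec.sum v → W π v * D ^ n ≤ Y ^ n
  moderate-sum π≤ρ {n} v le = begin
    W π v * D ^ n              ≡⟨ cong (W π v *_) (^-expand₃ ρ π₁ π₂ κ 132 κ n) ⟩
    W π v * (R * Q₁ * Q₂)      ≡⟨ reassoc′ (W π v) R Q₁ Q₂ ⟩
    W π v * R * (Q₁ * Q₂)      ≤⟨ *-monoˡ-≤ (Q₁ * Q₂) tilted ⟩
    E ^ n * P * (Q₁ * Q₂)      ≡⟨ rotate (E ^ n) P Q₁ Q₂ ⟩
    P * Q₁ * Q₂ * E ^ n        ≡⟨ cong (_* E ^ n) (sym (^-expand₃ π π₁ π₂ κ 132 κ n)) ⟩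
    (π ^ κ * π₁ ^ 132 * π₂ ^ κ) ^ n * E ^ n ≡⟨ sym (^-distribʳ-* _ E n) ⟩
    Y ^ n                      ∎
    where
    open ≤-Reasoning
    open Atoms n
    tilted : W π v * R ≤ E ^ n * P
    tilted = ≤-lower-exponent {w = W π v} {E ^ n} π≤ρ le (W-≤ v)
    reassoc′ : ∀ w r a b → w * (r * a * b) ≡ w * r * (a * b)
    reassoc′ = solve-∀
    rotate : ∀ e p a b → e * p * (a * b) ≡ p * a * b * e
    rotate = solve-∀

  large-sum : .{{_ : NonZero π₁}} → π ≤ π₁ → ∀ {n} (v : Vec ℕ n) → 132 * n ≤ 100 * Vec.sum v →
              W π v * D ^ n ≤ W π₁ v * D₁ ^ n
  large-sum π≤π₁ {n} v le = begin
    W π v * D ^ n              ≡⟨ cong (W π v *_) (^-expand₃ ρ π₁ π₂ κ 132 κ n) ⟩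
    W π v * (R * Q₁ * Q₂)      ≡⟨ rotate (W π v) R Q₁ Q₂ ⟩
    W π v * Q₁ * (R * Q₂)      ≤⟨ *-monoˡ-≤ (R * Q₂) tilted ⟩
    W π₁ v * P′ * (R * Q₂)     ≡⟨ reassoc (W π₁ v) P′ R Q₂ ⟩
    W π₁ v * (P′ * R * Q₂)     ≡⟨ cong (W π₁ v *_) (sym (^-expand₃ π ρ π₂ 132 κ κ n)) ⟩
    W π₁ v * D₁ ^ n            ∎
    where
    open ≤-Reasoning
    open Atoms n
    tilted : W π v * Q₁ ≤ W π₁ v * P′
    tilted = ≤-lower-exponent {w = W π v} {W π₁ v} π≤π₁ le (≤-reflexive (W-tilt π π₁ v))
    rotate : ∀ w r a b → w * (r * a * b) ≡ w * a * (r * b)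
    rotate = solve-∀

  W-split : .{{_ : NonZero π₁}} .{{_ : NonZero ρ}} → π₂ ≤ π → π ≤ π₁ → π ≤ ρ → ∀ {n} (v : Vec ℕ n) →
    (InA n v → W π v * D ^ n ≤ Y ^ n + (W π₁ v * D₁ ^ n + W π₂ v * D₂ ^ n)) ×
    (¬ InA n v → W π v * D ^ n ≤ W π₁ v * D₁ ^ n + W π₂ v * D₂ ^ n)
  W-split π₂≤π π≤π₁ π≤ρ {n} v = inside , outside
    where
    inside : InA n v → W π v * D ^ n ≤ Y ^ n + (W π₁ v * D₁ ^ n + W π₂ v * D₂ ^ n)
    inside _ with κ * n ≤? 100 * Vec.sum v
    ... | yes κn≤ = ≤-trans (moderate-sum π≤ρ v κn≤) (m≤m+n _ _)
    ... | no  κn≰ = ≤-trans (small-sum π₂≤π v (<⇒≤ (≰⇒> κn≰))) (≤-trans (m≤n+m _ _) (m≤n+m _ (Y ^ n)))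
    outside : ¬ InA n v → W π v * D ^ n ≤ W π₁ v * D₁ ^ n + W π₂ v * D₂ ^ n
    outside ∉A = ≤-trans (large-sum π≤π₁ v (<⇒≤ (≰⇒> ∉A))) (m≤m+n _ _)

  sumBy-W : ∀ {q} → m ≤ q → ∀ x c n → sumBy (λ v → W x v * c) (boxVecs q n) ≡ F x ^ n * c
  sumBy-W {q} m≤q x c n = trans (sumBy-*ʳ c (W x) (boxVecs q n)) (cong (_* c) (begin
    sumBy (W x) (boxVecs q n)                       ≡⟨ sumBy-prodBy-boxVecs q _ n ⟩
    sumBelow q (lowWeight m (x ^ 100) (ρ ^ 100)) ^ n ≡⟨ cong (_^ n) (sumBelow-lowWeight _ _ m≤q) ⟩
    F x ^ n                                         ∎))
    where open ≡-Reasoning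

  cardA-lower : .{{_ : NonZero π₁}} .{{_ : NonZero ρ}} → π₂ ≤ π → π ≤ π₁ → π ≤ ρ →
                ∀ q → m ≤ q → ∀ n → X₀ ^ n ≤ cardA q n * Y ^ n + (X₁ ^ n + X₂ ^ n)
  cardA-lower π₂≤π π≤π₁ π≤ρ q m≤q n = begin
    X₀ ^ n                                     ≡⟨ ^-distribʳ-* (F π) D n ⟩
    F π ^ n * D ^ n                            ≡⟨ sym (sumBy-W m≤q π (D ^ n) n) ⟩
    sumBy (λ v → W π v * D ^ n) B              ≤⟨ sumBy≤length-filter*+sumBy (inA? n) _ _ (Y ^ n) (W-split π₂≤π π≤π₁ π≤ρ) B ⟩
    cardA q n * Y ^ n + sumBy (λ v → W π₁ v * D₁ ^ n + W π₂ v * D₂ ^ n) B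
      ≡⟨ cong (cardA q n * Y ^ n +_) (trans (sumBy-+ _ _ B) (cong₂ _+_ (sumBy-W m≤q π₁ (D₁ ^ n) n) (sumBy-W m≤q π₂ (D₂ ^ n) n))) ⟩
    cardA q n * Y ^ n + (F π₁ ^ n * D₁ ^ n + F π₂ ^ n * D₂ ^ n)
      ≡⟨ cong (cardA q n * Y ^ n +_) (sym (cong₂ _+_ (^-distribʳ-* (F π₁) D₁ n) (^-distribʳ-* (F π₂) D₂ n))) ⟩
    cardA q n * Y ^ n + (X₁ ^ n + X₂ ^ n)      ∎
    where
    open ≤-Reasoning
    B = boxVecs q n

-- Certificates

≤! : ∀ {m n} {_ : T (m ≤ᵇ n)} → m ≤ n
≤! {m} {n} {m≤ᵇn} = ≤ᵇ⇒≤ m n m≤ᵇn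

viaExactSum : ∀ q a b πa ρa π π₁ π₂ ρ κ .{{_ : NonZero b}} .{{_ : NonZero ρa}} .{{_ : NonZero π₁}} .{{_ : NonZero ρ}} →
  b ≤ a → πa ≤ ρa → π₂ ≤ π → π ≤ π₁ → π ≤ ρ →
  let open UpperBound a b πa ρa
      open LowerBound q π π₁ π₂ ρ κ
  in X₁ < X₀ → X₂ < X₀ → 1 ≤ G q → suc (G q * Y) < M q * X₀ →
     ExponentiallySmaller (cardAB q) (cardA q)
viaExactSum q a b πa ρa π π₁ π₂ ρ κ b≤a πa≤ρa π₂≤π π≤π₁ π≤ρ =
  exponentialRatioBound (cardAB q) (cardA q) (M q) (G q) X₀ Y X₁ X₂
    (cardAB-upper b≤a πa≤ρa q) (cardA-lower π₂≤π π≤π₁ π≤ρ q ≤-refl)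
  where
  open UpperBound a b πa ρa
  open LowerBound q π π₁ π₂ ρ κ

viaGeometricSum : ∀ k → ExponentiallySmaller (cardAB (7 + k)) (cardA (7 + k))
viaGeometricSum k =
  exponentialRatioBound (cardAB q) (cardA q) (M′ d) (G′ d) X₀ Y X₁ X₂
    (cardAB-upper-uniform ≤! ≤! {d} refl q) (cardA-lower ≤! ≤! ≤! q (m≤m+n 7 k)) ≤! ≤! ≤! ≤!
  where
  q = 7 + k
  d = 10000 ^ 100 ∸ 9960 ^ 100
  open UpperBound 1039 1000 9960 10000
  open LowerBound 7 9949 9950 9948 10000 128

mainTheorem4 : (q : ℕ) → 2 ≤ q →
    ∃ λ a → ∃ λ b → 1 ≤ b × b < a ×
      ∃ λ N → ∀ n → N ≤ n → 1 ≤ n →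
        cardAB q n * a ^ n < cardA q n * b ^ n
mainTheorem4 0 ()
mainTheorem4 1 (s≤s ())
mainTheorem4 2 _ = viaExactSum 2 1010 1000 1    1     1000 1001 0    1000  0   ≤! ≤! ≤! ≤! ≤! ≤! ≤! ≤! ≤!
mainTheorem4 3 _ = viaExactSum 3 1038 1000 1    1     1000 1001 0    1000  0   ≤! ≤! ≤! ≤! ≤! ≤! ≤! ≤! ≤!
mainTheorem4 4 _ = viaExactSum 4 1055 1000 1    1     9985 9986 9984 10000 130 ≤! ≤! ≤! ≤! ≤! ≤! ≤! ≤! ≤!
mainTheorem4 5 _ = viaExactSum 5 1059 1000 1    1     9963 9964 9962 10000 129 ≤! ≤! ≤! ≤! ≤! ≤! ≤! ≤! ≤!
mainTheorem4 6 _ = viaExactSum 6 1059 1000 9990 10000 9954 9955 9953 10000 129 ≤! ≤! ≤! ≤! ≤! ≤! ≤! ≤! ≤!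
mainTheorem4 (suc (suc (suc (suc (suc (suc (suc k))))))) _ = viaGeometricSum k
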